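{- Let $p$ be a prime, $n\ge1$, $R$ an $\mathbb{F}_p$-algebra and $\lambda\in R$. Then the group algebra scheme of $\varGamma^{(\lambda)}_R$ is $A(\varGamma^{(\lambda)}_R)=\mathrm{Spec}\,R[X_1,X_T,X_{T^2},\dots,X_{T^{p^n-1}}]$ (where $X_{T^s}(f)=f(T^s)$, $X_1=X_{T^0}$), with multiplication given on coordinate rings by $X_1\mapsto X_1\otimes X_1$ and $$X_{T^s}\mapsto\sum_{l=0}^s\binom{s}{l}\Big(\sum_{k=0}^l\binom{l}{k}\lambda^kX_{T^{k+s-l}}\Big)\otimes X_{T^l}\quad(1\le s\le p^n-1),$$ and multiplicative identity given by $X_1\mapsto1$, $X_{T^s}\mapsto0$ for $1\le s\le p^n-1$. Moreover the unit group scheme is $U(\varGamma^{(\lambda)}_R)=\mathrm{Spec}\,R[X_1,X_T,\dots,X_{T^{p^n-1}},1/\Delta]$, where $\Delta=X_1\prod_{l=1}^{p^n-1}\big(\sum_{k=0}^l\binom{l}{k}\lambda^kX_{T^k}\big)$.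
   Context: $\varGamma^{(\lambda)}_R=\mathrm{Spec}\,R[T]/(T^{p^n})$ is the finite flat commutative group scheme with comultiplication $T\mapsto T\otimes1+1\otimes T+\lambda T\otimes T$ and counit $T\mapsto0$. For an affine $R$-group scheme $\varGamma=\mathrm{Spec}\,H$ with $H$ finite free over $R$, the group algebra scheme $A(\varGamma)$ is the ring functor $A\mapsto\mathrm{Hom}_R(H,A)$ on $R$-algebras with the convolution product $f*g=m_A\circ(f\otimes g)\circ\Delta_H$ (identity the counit), and $U(\varGamma)$ is $A\mapsto\mathrm{Hom}_R(H,A)^\times$. Coordinates refer to the basis $1,T,\dots,T^{p^n-1}$ of $R[T]/(T^{p^n})$. -}

module Defs where

open import Level using (Level; _⊔_)
import Data.Nat
open import Data.Nat using (ℕ; zero; suc; _≡ᵇ_)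
open import Data.Nat.Combinatorics using (_C_)
open import Data.Fin using (Fin; toℕ)
open import Data.Bool using (if_then_else_; _∧_)
open import Data.Product using (Σ; _×_)
open import Algebra.Bundles using (CommutativeRing)
open import Algebra.Morphism.Structures using (module RingMorphisms)

module RingOps {c ℓ : Level} (R : CommutativeRing c ℓ) where
  open CommutativeRing R

  fromℕ : ℕ → Carrier
  fromℕ zero    = 0#
  fromℕ (suc m) = 1# + fromℕ m

  pow : Carrier → ℕ → Carrier
  pow x zero    = 1#
  pow x (suc m) = x * pow x m

  sumFin : (m : ℕ) → (Fin m → Carrier) → Carrier
  sumFin zero    g = 0#
  sumFin (suc m) g = g Fin.zero + sumFin m (λ i → g (Fin.suc i))

  sumUpTo : ℕ → (ℕ → Carrier) → Carrier
  sumUpTo zero    g = 0#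
  sumUpTo (suc m) g = sumUpTo m g + g m

  prodFrom : ℕ → ℕ → (ℕ → Carrier) → Carrier
  prodFrom a zero    g = 1#
  prodFrom a (suc m) g = g a * prodFrom (suc a) m g

-- R is an F_p-algebra: p · 1 = 0 in R.
CharP : {c ℓ : Level} → CommutativeRing c ℓ → ℕ → Set ℓ
CharP R p = RingOps.fromℕ R p ≈ 0#
  where open CommutativeRing R

IsAlgebraMap : {c ℓ a ℓa : Level} (R : CommutativeRing c ℓ) (A : CommutativeRing a ℓa)
               → (CommutativeRing.Carrier R → CommutativeRing.Carrier A) → Set (c ⊔ ℓ ⊔ ℓa)
IsAlgebraMap R A ι =
  RingMorphisms.IsRingHomomorphism (CommutativeRing.rawRing R) (CommutativeRing.rawRing A) ι

-- The group algebra scheme of Γ^(λ)_R = Spec R[T]/(T^N), evaluated at the R-algebra A.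
-- H = R[T]/(T^N) is represented by coefficient vectors w.r.t. the basis 1,T,…,T^(N-1);
-- H ⊗_R H is free with basis T^i ⊗ T^j and is represented by coefficient matrices.
module GroupAlgebra {c ℓ a ℓa : Level}
    (R : CommutativeRing c ℓ) (A : CommutativeRing a ℓa)
    (ι : CommutativeRing.Carrier R → CommutativeRing.Carrier A)
    (lam : CommutativeRing.Carrier R) (N : ℕ) where

  module R = CommutativeRing R
  module A = CommutativeRing A
  module OR = RingOps R
  module OA = RingOps A

  H : Set c
  H = Fin N → R.Carrier

  H⊗H : Set c
  H⊗H = Fin N → Fin N → R.Carrier

  _+H_ : H → H → H
  (h +H h') i = h i R.+ h' i

  _•H_ : R.Carrier → H → H
  (r •H h) i = r R.* h i

  _≈H_ : H → H → Set ℓ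
  h ≈H h' = ∀ i → h i R.≈ h' i

  -- basis element T^s of H (T^s = 0 for s ≥ N)
  e : ℕ → H
  e s i = if toℕ i ≡ᵇ s then R.1# else R.0#

  e⊗ : ℕ → ℕ → H⊗H
  e⊗ i j a b = if (toℕ a ≡ᵇ i) ∧ (toℕ b ≡ᵇ j) then R.1# else R.0#

  _+⊗_ : H⊗H → H⊗H → H⊗H
  (x +⊗ y) a b = x a b R.+ y a b

  _•⊗_ : R.Carrier → H⊗H → H⊗H
  (r •⊗ x) a b = r R.* x a b

  -- ring multiplication of H ⊗ H = R[T,T']/(T^N, T'^N)
  _*⊗_ : H⊗H → H⊗H → H⊗H
  (x *⊗ y) i j =
    OR.sumFin N λ a → OR.sumFin N λ b → OR.sumFin N λ a' → OR.sumFin N λ b' →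
      if (toℕ a Data.Nat.+ toℕ a' ≡ᵇ toℕ i) ∧ (toℕ b Data.Nat.+ toℕ b' ≡ᵇ toℕ j)
      then x a b R.* y a' b' else R.0#

  pow⊗ : H⊗H → ℕ → H⊗H
  pow⊗ x zero    = e⊗ 0 0
  pow⊗ x (suc m) = x *⊗ pow⊗ x m

  ΔT : H⊗H
  ΔT = (e⊗ 1 0 +⊗ e⊗ 0 1) +⊗ (lam •⊗ e⊗ 1 1)

  Δ_H : H → H⊗H
  Δ_H h a b = OR.sumFin N λ s → h s R.* pow⊗ ΔT (toℕ s) a b

  ε_H : H → R.Carrier
  ε_H h = OR.sumFin N λ s → if toℕ s ≡ᵇ 0 then h s else R.0#

  -- A-points of A(Γ): R-linear maps H → A (A viewed as R-module via ι)
  record Lin : Set (a ⊔ c ⊔ ℓ ⊔ ℓa) where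
    field
      fun   : H → A.Carrier
      cong  : ∀ {h h'} → h ≈H h' → fun h A.≈ fun h'
      +-lin : ∀ h h' → fun (h +H h') A.≈ (fun h A.+ fun h')
      •-lin : ∀ r h → fun (r •H h) A.≈ (ι r A.* fun h)
  open Lin public

  X : Lin → ℕ → A.Carrier
  X f s = fun f (e s)

  -- convolution  f * g = m_A ∘ (f ⊗ g) ∘ Δ_H   (computed on the basis T^i ⊗ T^j of H ⊗ H)
  conv : Lin → Lin → H → A.Carrier
  conv f g h = OA.sumFin N λ i → OA.sumFin N λ j →
                 ι (Δ_H h i j) A.* (X f (toℕ i) A.* X g (toℕ j))

  one : H → A.Carrier
  one h = ι (ε_H h)

  productFormula : Lin → Lin → ℕ → A.Carrier
  productFormula f g s =
    OA.sumUpTo (suc s) λ l →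
      OA.fromℕ (s C l) A.*
        ((OA.sumUpTo (suc l) λ k →
            OA.fromℕ (l C k) A.* (OA.pow (ι lam) k A.* X f (k Data.Nat.+ (s Data.Nat.∸ l))))
         A.* X g l)

  Disc : Lin → A.Carrier
  Disc f = X f 0 A.* OA.prodFrom 1 (N Data.Nat.∸ 1) λ l →
             OA.sumUpTo (suc l) λ k → OA.fromℕ (l C k) A.* (OA.pow (ι lam) k A.* X f k)

{-# OPTIONS --safe #-}
-- Write ΔT = T ⊗ 1 + 1 ⊗ T + λ T ⊗ T = T ⊗ 1 + (1 + λT) ⊗ T. The binomial theorem gives
-- Δ(T^s) = ΔT^s = Σ_l C(s,l) T^(s-l) (1 + λT)^l ⊗ T^l, and since
-- f (T^m (1 + λT)^l) = Σ_k C(l,k) λ^k X_{T^(k+m)}(f), pairing with f ⊗ g is the product formula.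
-- Because 1 + λΔT = (1 + λT) ⊗ (1 + λT), the elements (1 + λT)^l are grouplike, so an invertible f
-- takes invertible values f ((1 + λT)^l); these are exactly the factors of Δ(f). Conversely, in the
-- coordinates X_{T^j}(g) the equation f * g = 1 is a lower-triangular linear system whose diagonal
-- entries are the same values f ((1 + λT)^s), hence solvable when Δ(f) is a unit; ΔT is symmetric,
-- so the convolution is commutative and this right inverse is two-sided.
module Submission where

open import Defs
open import Level using (Level)
open import Data.Nat using (ℕ; _^_; _≤_; _<_; _≡ᵇ_)
open import Data.Nat.Primality using (Prime)
open import Data.Fin using (Fin; toℕ)
open import Data.Bool using (if_then_else_)
open import Data.Product using (Σ; _×_)
open import Algebra.Bundles using (CommutativeRing)

open import Data.Nat as ℕ using (zero; suc; _∸_; z≤n; s≤s)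
open import Data.Nat.Properties as ℕₚ
  using ( ≤-refl; ≤-reflexive; ≤-trans; <-trans; <-≤-trans; ≤-<-trans; <-irrefl; <⇒≤; ≤-pred; ≮⇒≥; n<1+n; n≤1+n
        ; m<n⇒m<1+n; m<1+n⇒m<n∨m≡n; m≤n⇒m<n∨m≡n; m<m+n; m≤n+m; m+[n∸m]≡n; n∸n≡0; +-∸-assoc; ^-monoʳ-≤)
import Data.Nat.Primality as Primality
open import Data.Nat.Combinatorics using (_C_; nCk+nC[k+1]≡[n+1]C[k+1]; k>n⇒nCk≡0; nCn≡1)
open import Data.Fin using (fromℕ<)
import Data.Fin.Properties as Finₚ
open import Data.Bool using (Bool; true; false; _∧_)
open import Data.Empty using (⊥-elim)
open import Data.Product using (_,_; proj₁; proj₂)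
open import Data.Sum using (inj₁; inj₂)
open import Relation.Nullary using (yes; no)
open import Relation.Binary.PropositionalEquality as ≡ using (_≡_)
open import Algebra.Definitions using (RightInvertible)
open import Algebra.Morphism.Structures using (module RingMorphisms)
import Algebra.Properties.Semiring.Sum as SemiringSum
import Algebra.Properties.AbelianGroup as AbelianGroupProperties
import Algebra.Properties.CommutativeSemigroup as CommutativeSemigroupProperties
import Algebra.Solver.Ring.NaturalCoefficients.Default as NaturalSolver
import Relation.Binary.Reasoning.Setoid as SetoidReasoning

≡ᵇ-refl : ∀ m → (m ≡ᵇ m) ≡ true
≡ᵇ-refl zero    = ≡.refl
≡ᵇ-refl (suc m) = ≡ᵇ-refl m

<⇒≡ᵇ-false : ∀ {m n} → m < n → (m ≡ᵇ n) ≡ false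
<⇒≡ᵇ-false {zero}  {suc n} _         = ≡.refl
<⇒≡ᵇ-false {suc m} {suc n} (s≤s m<n) = <⇒≡ᵇ-false m<n

≡ᵇ-sym : ∀ m n → (m ≡ᵇ n) ≡ (n ≡ᵇ m)
≡ᵇ-sym zero    zero    = ≡.refl
≡ᵇ-sym zero    (suc n) = ≡.refl
≡ᵇ-sym (suc m) zero    = ≡.refl
≡ᵇ-sym (suc m) (suc n) = ≡ᵇ-sym m n

module Sums {c ℓ : Level} (K : CommutativeRing c ℓ) where
  open CommutativeRing K
  open RingOps K public
  open SemiringSum semiring using (sum; ∑-distrib-+; ∑-comm; *-distribˡ-sum; *-distribʳ-sum)
  open SetoidReasoning setoid

  ≡⇒≈ : ∀ {x y} → x ≡ y → x ≈ y
  ≡⇒≈ ≡.refl = refl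

  sumFin-cong : ∀ m {g h : Fin m → Carrier} → (∀ i → g i ≈ h i) → sumFin m g ≈ sumFin m h
  sumFin-cong zero    g≈h = refl
  sumFin-cong (suc m) g≈h = +-cong (g≈h Fin.zero) (sumFin-cong m (λ i → g≈h (Fin.suc i)))

  sumFin≡sum : ∀ m (g : Fin m → Carrier) → sumFin m g ≡ sum g
  sumFin≡sum zero    g = ≡.refl
  sumFin≡sum (suc m) g = ≡.cong (g Fin.zero +_) (sumFin≡sum m (λ i → g (Fin.suc i)))

  sumFin-+ : ∀ m (g h : Fin m → Carrier) → sumFin m (λ i → g i + h i) ≈ sumFin m g + sumFin m h
  sumFin-+ m g h = begin
    sumFin m (λ i → g i + h i) ≡⟨ sumFin≡sum m _ ⟩
    sum (λ i → g i + h i)      ≈⟨ ∑-distrib-+ g h ⟩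
    sum g + sum h              ≡⟨ ≡.cong₂ _+_ (≡.sym (sumFin≡sum m g)) (≡.sym (sumFin≡sum m h)) ⟩
    sumFin m g + sumFin m h    ∎

  sumFin-*ˡ : ∀ m r (g : Fin m → Carrier) → r * sumFin m g ≈ sumFin m (λ i → r * g i)
  sumFin-*ˡ m r g = begin
    r * sumFin m g           ≡⟨ ≡.cong (r *_) (sumFin≡sum m g) ⟩
    r * sum g                ≈⟨ *-distribˡ-sum r g ⟩
    sum (λ i → r * g i)      ≡⟨ ≡.sym (sumFin≡sum m _) ⟩
    sumFin m (λ i → r * g i) ∎

  sumFin-*ʳ : ∀ m r (g : Fin m → Carrier) → sumFin m g * r ≈ sumFin m (λ i → g i * r)
  sumFin-*ʳ m r g = begin
    sumFin m g * r           ≡⟨ ≡.cong (_* r) (sumFin≡sum m g) ⟩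
    sum g * r                ≈⟨ *-distribʳ-sum r g ⟩
    sum (λ i → g i * r)      ≡⟨ ≡.sym (sumFin≡sum m _) ⟩
    sumFin m (λ i → g i * r) ∎

  sumFin-comm : ∀ m n (g : Fin m → Fin n → Carrier) →
    sumFin m (λ i → sumFin n (g i)) ≈ sumFin n (λ j → sumFin m (λ i → g i j))
  sumFin-comm m n g = begin
    sumFin m (λ i → sumFin n (g i))          ≈⟨ sumFin-cong m (λ i → ≡⇒≈ (sumFin≡sum n (g i))) ⟩
    sumFin m (λ i → sum (g i))               ≡⟨ sumFin≡sum m _ ⟩
    sum (λ i → sum (g i))                    ≈⟨ ∑-comm g ⟩
    sum (λ j → sum (λ i → g i j))            ≡⟨ sumFin≡sum n _ ⟨
    sumFin n (λ j → sum (λ i → g i j))       ≈⟨ sumFin-cong n (λ j → ≡⇒≈ (sumFin≡sum m (λ i → g i j))) ⟨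
    sumFin n (λ j → sumFin m (λ i → g i j))  ∎

  x≈0⇒x*y≈0 : ∀ {x y} → x ≈ 0# → x * y ≈ 0#
  x≈0⇒x*y≈0 {x} {y} x≈0 = trans (*-congʳ x≈0) (zeroˡ y)

  y≈0⇒x*y≈0 : ∀ {x y} → y ≈ 0# → x * y ≈ 0#
  y≈0⇒x*y≈0 {x} {y} y≈0 = trans (*-congˡ y≈0) (zeroʳ x)

  ∑< : ℕ → (ℕ → Carrier) → Carrier
  ∑< m G = sumFin m (λ i → G (toℕ i))

  ∑<-+ : ∀ m (G H : ℕ → Carrier) → ∑< m (λ k → G k + H k) ≈ ∑< m G + ∑< m H
  ∑<-+ m G H = sumFin-+ m (λ i → G (toℕ i)) (λ i → H (toℕ i))

  ∑<-*ˡ : ∀ m r (G : ℕ → Carrier) → r * ∑< m G ≈ ∑< m (λ k → r * G k)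
  ∑<-*ˡ m r G = sumFin-*ˡ m r (λ i → G (toℕ i))

  ∑<-combination : ∀ m (G H L : ℕ → Carrier) r →
    ∑< m (λ k → (G k + H k) + r * L k) ≈ (∑< m G + ∑< m H) + r * ∑< m L
  ∑<-combination m G H L r = trans (∑<-+ m (λ k → G k + H k) (λ k → r * L k)) (+-cong (∑<-+ m G H) (sym (∑<-*ˡ m r L)))

  ∑<-cong : ∀ m {G H : ℕ → Carrier} → (∀ k → k < m → G k ≈ H k) → ∑< m G ≈ ∑< m H
  ∑<-cong zero    G≈H = refl
  ∑<-cong (suc m) G≈H = +-cong (G≈H 0 (s≤s z≤n)) (∑<-cong m (λ k k<m → G≈H (suc k) (s≤s k<m)))

  ∑<-zero : ∀ m {G : ℕ → Carrier} → (∀ k → k < m → G k ≈ 0#) → ∑< m G ≈ 0#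
  ∑<-zero zero    G≈0 = refl
  ∑<-zero (suc m) G≈0 =
    trans (+-cong (G≈0 0 (s≤s z≤n)) (∑<-zero m (λ k k<m → G≈0 (suc k) (s≤s k<m)))) (+-identityˡ 0#)

  ∑<-suc : ∀ m (G : ℕ → Carrier) → ∑< (suc m) G ≈ ∑< m G + G m
  ∑<-suc zero    G = trans (+-identityʳ _) (sym (+-identityˡ _))
  ∑<-suc (suc m) G = trans (+-congˡ (∑<-suc m (λ k → G (suc k)))) (sym (+-assoc _ _ _))

  ∑<-truncate : ∀ {a b} (G : ℕ → Carrier) → a ≤ b → (∀ k → a ≤ k → G k ≈ 0#) → ∑< b G ≈ ∑< a G
  ∑<-truncate {zero}  {b}     G a≤b G≈0 = ∑<-zero b (λ k _ → G≈0 k z≤n)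
  ∑<-truncate {suc a} {suc b} G (s≤s a≤b) G≈0 =
    +-congˡ (∑<-truncate (λ k → G (suc k)) a≤b (λ k a≤k → G≈0 (suc k) (s≤s a≤k)))

  ∑<-shift : ∀ m n (G : ℕ → Carrier) → (∀ k → k < m → G k ≈ 0#) → ∑< (m ℕ.+ n) G ≈ ∑< n (λ k → G (m ℕ.+ k))
  ∑<-shift zero    n G G≈0 = refl
  ∑<-shift (suc m) n G G≈0 = trans
    (+-cong (G≈0 0 (s≤s z≤n)) (∑<-shift m n (λ k → G (suc k)) (λ k k<m → G≈0 (suc k) (s≤s k<m))))
    (+-identityˡ _)

  sumUpTo-cong : ∀ m {G H : ℕ → Carrier} → (∀ k → G k ≈ H k) → sumUpTo m G ≈ sumUpTo m H
  sumUpTo-cong zero    G≈H = refl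
  sumUpTo-cong (suc m) G≈H = +-cong (sumUpTo-cong m G≈H) (G≈H m)

  sumUpTo≈∑< : ∀ m (G : ℕ → Carrier) → sumUpTo m G ≈ ∑< m G
  sumUpTo≈∑< zero    G = refl
  sumUpTo≈∑< (suc m) G = trans (+-congʳ (sumUpTo≈∑< m G)) (sym (∑<-suc m G))

  if0-cong : ∀ b {x y} → x ≈ y → (if b then x else 0#) ≈ (if b then y else 0#)
  if0-cong true  x≈y = x≈y
  if0-cong false x≈y = refl

  if0-+ : ∀ b x y → (if b then x + y else 0#) ≈ (if b then x else 0#) + (if b then y else 0#)
  if0-+ true  x y = refl
  if0-+ false x y = sym (+-identityˡ 0#)

  if0-*ˡ : ∀ b r x → (if b then r * x else 0#) ≈ r * (if b then x else 0#)
  if0-*ˡ true  r x = refl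
  if0-*ˡ false r x = sym (zeroʳ r)

  if0-∧ : ∀ b b′ x → (if b ∧ b′ then x else 0#) ≈ (if b then (if b′ then x else 0#) else 0#)
  if0-∧ true  b′ x = refl
  if0-∧ false b′ x = refl

  if01-* : ∀ b x → (if b then 1# else 0#) * x ≈ (if b then x else 0#)
  if01-* true  x = *-identityˡ x
  if01-* false x = zeroˡ x

  sumFin-if0 : ∀ m b (g : Fin m → Carrier) →
    sumFin m (λ i → if b then g i else 0#) ≈ (if b then sumFin m g else 0#)
  sumFin-if0 m true  g = refl
  sumFin-if0 m false g = ∑<-zero m (λ _ _ → refl)

  sumFin-indicator : ∀ {m} (k : Fin m) (g : Fin m → Carrier) →
    sumFin m (λ i → if toℕ i ≡ᵇ toℕ k then g i else 0#) ≈ g k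
  sumFin-indicator {suc m} Fin.zero    g = trans (+-congˡ (∑<-zero m (λ _ _ → refl))) (+-identityʳ _)
  sumFin-indicator {suc m} (Fin.suc k) g = trans (+-identityˡ _) (sumFin-indicator k (λ i → g (Fin.suc i)))

  -- If G lists the coefficients of a polynomial P, then shift u G lists those of T^u · P.
  shift : ℕ → (ℕ → Carrier) → ℕ → Carrier
  shift zero    G i       = G i
  shift (suc u) G zero    = 0#
  shift (suc u) G (suc i) = shift u G i

  shift-cong : ∀ u {G H : ℕ → Carrier} → (∀ k → G k ≈ H k) → ∀ i → shift u G i ≈ shift u H i
  shift-cong zero    G≈H i       = G≈H i
  shift-cong (suc u) G≈H zero    = refl
  shift-cong (suc u) G≈H (suc i) = shift-cong u G≈H i

  shift-0 : ∀ u i → shift u (λ _ → 0#) i ≡ 0#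
  shift-0 zero    i       = ≡.refl
  shift-0 (suc u) zero    = ≡.refl
  shift-0 (suc u) (suc i) = shift-0 u i

  shift-+ : ∀ u (G H : ℕ → Carrier) i → shift u (λ k → G k + H k) i ≈ shift u G i + shift u H i
  shift-+ zero    G H i       = refl
  shift-+ (suc u) G H zero    = sym (+-identityˡ 0#)
  shift-+ (suc u) G H (suc i) = shift-+ u G H i

  shift-*ˡ : ∀ u r (G : ℕ → Carrier) i → shift u (λ k → r * G k) i ≈ r * shift u G i
  shift-*ˡ zero    r G i       = refl
  shift-*ˡ (suc u) r G zero    = sym (zeroʳ r)
  shift-*ˡ (suc u) r G (suc i) = shift-*ˡ u r G i

  shift-*ʳ : ∀ u r (G : ℕ → Carrier) i → shift u (λ k → G k * r) i ≈ shift u G i * r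
  shift-*ʳ zero    r G i       = refl
  shift-*ʳ (suc u) r G zero    = sym (zeroˡ r)
  shift-*ʳ (suc u) r G (suc i) = shift-*ʳ u r G i

  shift-∑< : ∀ u m (G : ℕ → ℕ → Carrier) i →
    shift u (λ k → ∑< m (λ t → G t k)) i ≈ ∑< m (λ t → shift u (G t) i)
  shift-∑< zero    m G i       = refl
  shift-∑< (suc u) m G zero    = sym (∑<-zero m (λ _ _ → refl))
  shift-∑< (suc u) m G (suc i) = shift-∑< u m G i

  shift-below : ∀ {u i} (G : ℕ → Carrier) → i < u → shift u G i ≡ 0#
  shift-below {suc u} {zero}  G _         = ≡.refl
  shift-below {suc u} {suc i} G (s≤s i<u) = shift-below G i<u

  shift-offset : ∀ u (G : ℕ → Carrier) k → shift u G (u ℕ.+ k) ≡ G k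
  shift-offset zero    G k = ≡.refl
  shift-offset (suc u) G k = shift-offset u G k

  shift-1-shift : ∀ u (G : ℕ → Carrier) i → shift 1 (shift u G) i ≡ shift (suc u) G i
  shift-1-shift u G zero    = ≡.refl
  shift-1-shift u G (suc i) = ≡.refl

  shift-1-scaled : ∀ {F : ℕ → Carrier} r u G → (∀ k → F k ≈ r * shift u G k) →
    ∀ i → shift 1 F i ≈ r * shift (suc u) G i
  shift-1-scaled {F} r u G F≈rG i = begin
    shift 1 F i                      ≈⟨ shift-cong 1 F≈rG i ⟩
    shift 1 (λ k → r * shift u G k) i ≈⟨ shift-*ˡ 1 r (shift u G) i ⟩
    r * shift 1 (shift u G) i        ≡⟨ ≡.cong (r *_) (shift-1-shift u G i) ⟩
    r * shift (suc u) G i            ∎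

  shift-suc : ∀ u (G : ℕ → Carrier) i → shift u (shift 1 G) i ≡ shift (suc u) G i
  shift-suc zero    G i       = ≡.refl
  shift-suc (suc u) G zero    = ≡.refl
  shift-suc (suc u) G (suc i) = shift-suc u G i

  ∑<-indicator : ∀ {m i} (G : ℕ → Carrier) → i < m → ∑< m (λ a → if a ≡ᵇ i then G a else 0#) ≈ G i
  ∑<-indicator {suc m} {zero}  G _ = trans (+-congˡ (∑<-zero m (λ _ _ → refl))) (+-identityʳ _)
  ∑<-indicator {suc m} {suc i} G (s≤s i<m) = trans (+-identityˡ _) (∑<-indicator (λ a → G (suc a)) i<m)

  ∑<-indicator-shift : ∀ u {m i} (G : ℕ → Carrier) → i < m →
    ∑< m (λ a → if u ℕ.+ a ≡ᵇ i then G a else 0#) ≈ shift u G i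
  ∑<-indicator-shift zero    G i<m = ∑<-indicator G i<m
  ∑<-indicator-shift (suc u) {m} {zero}  G _ = ∑<-zero m (λ _ _ → refl)
  ∑<-indicator-shift (suc u) {m} {suc i} G i<m = ∑<-indicator-shift u G (<-trans (n<1+n i) i<m)

  shift² : ℕ → ℕ → (ℕ → ℕ → Carrier) → ℕ → ℕ → Carrier
  shift² u v F i j = shift u (λ a → shift v (F a) j) i

  shift²-cong : ∀ u v {F G : ℕ → ℕ → Carrier} → (∀ a b → F a b ≈ G a b) →
    ∀ i j → shift² u v F i j ≈ shift² u v G i j
  shift²-cong u v F≈G i j = shift-cong u (λ a → shift-cong v (F≈G a) j) i

  shift²-comm : ∀ u v (F : ℕ → ℕ → Carrier) i j → shift² u v F i j ≈ shift² v u (λ b a → F a b) j i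
  shift²-comm zero    v F i       j = refl
  shift²-comm (suc u) v F zero    j = ≡⇒≈ (≡.sym (shift-0 v j))
  shift²-comm (suc u) v F (suc i) j = shift²-comm u v F i j

  shift²-∑< : ∀ u v m (c : ℕ → Carrier) (F : ℕ → ℕ → ℕ → Carrier) i j →
    shift² u v (λ a b → ∑< m (λ t → c t * F t a b)) i j ≈ ∑< m (λ t → c t * shift² u v (F t) i j)
  shift²-∑< u v m c F i j = begin
    shift u (λ a → shift v (λ b → ∑< m (λ t → c t * F t a b)) j) i
      ≈⟨ shift-cong u (λ a → trans (shift-∑< v m (λ t b → c t * F t a b) j)
                                   (∑<-cong m (λ t _ → shift-*ˡ v (c t) (F t a) j))) i ⟩
    shift u (λ a → ∑< m (λ t → c t * shift v (F t a) j)) i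
      ≈⟨ trans (shift-∑< u m (λ t a → c t * shift v (F t a) j) i)
               (∑<-cong m (λ t _ → shift-*ˡ u (c t) (λ a → shift v (F t a) j) i)) ⟩
    ∑< m (λ t → c t * shift² u v (F t) i j) ∎

  ∑<²-indicator-shift : ∀ u v {m i j} (F : ℕ → ℕ → Carrier) → i < m → j < m →
    ∑< m (λ a → ∑< m (λ b → if (u ℕ.+ a ≡ᵇ i) ∧ (v ℕ.+ b ≡ᵇ j) then F a b else 0#)) ≈ shift² u v F i j
  ∑<²-indicator-shift u v {m} {i} {j} F i<m j<m = begin
    ∑< m (λ a → ∑< m (λ b → if (u ℕ.+ a ≡ᵇ i) ∧ (v ℕ.+ b ≡ᵇ j) then F a b else 0#))
      ≈⟨ ∑<-cong m (λ a _ → trans (sumFin-cong m (λ b → if0-∧ (u ℕ.+ a ≡ᵇ i) _ (F a (toℕ b))))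
                                  (sumFin-if0 m (u ℕ.+ a ≡ᵇ i) _)) ⟩
    ∑< m (λ a → if u ℕ.+ a ≡ᵇ i then ∑< m (λ b → if v ℕ.+ b ≡ᵇ j then F a b else 0#) else 0#)
      ≈⟨ ∑<-cong m (λ a _ → if0-cong (u ℕ.+ a ≡ᵇ i) (∑<-indicator-shift v (F a) j<m)) ⟩
    ∑< m (λ a → if u ℕ.+ a ≡ᵇ i then shift v (F a) j else 0#)
      ≈⟨ ∑<-indicator-shift u _ i<m ⟩
    shift² u v F i j ∎

  ∑<²-indicator : ∀ {m u v} (W : ℕ → ℕ → Carrier) → u < m → v < m →
    ∑< m (λ a → ∑< m (λ b → (if (a ≡ᵇ u) ∧ (b ≡ᵇ v) then 1# else 0#) * W a b)) ≈ W u v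
  ∑<²-indicator {m} {u} {v} W u<m v<m = trans
    (∑<-cong m (λ a _ → ∑<-cong m (λ b _ → if01-* ((a ≡ᵇ u) ∧ (b ≡ᵇ v)) (W a b))))
    (∑<²-indicator-shift 0 0 W u<m v<m)

  fromℕ-+ : ∀ m n → fromℕ (m ℕ.+ n) ≈ fromℕ m + fromℕ n
  fromℕ-+ zero    n = sym (+-identityˡ _)
  fromℕ-+ (suc m) n = trans (+-congˡ (fromℕ-+ m n)) (sym (+-assoc _ _ _))

module Units {c ℓ : Level} (K : CommutativeRing c ℓ) where
  open CommutativeRing K
  open Sums K
  open AbelianGroupProperties +-abelianGroup using (xyx⁻¹≈y)
  open SetoidReasoning setoid

  IsUnit : Carrier → Set _
  IsUnit = RightInvertible _≈_ 1# _*_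

  IsUnit-resp : ∀ {x y} → x ≈ y → IsUnit x → IsUnit y
  IsUnit-resp x≈y (u , xu≈1) = u , trans (*-congʳ (sym x≈y)) xu≈1

  *-IsUnit : ∀ {x y} → IsUnit x → IsUnit y → IsUnit (x * y)
  *-IsUnit {x} {y} (u , xu≈1) (v , yv≈1) = u * v , (begin
    (x * y) * (u * v) ≈⟨ interchange x y u v ⟩
    (x * u) * (y * v) ≈⟨ *-cong xu≈1 yv≈1 ⟩
    1# * 1#           ≈⟨ *-identityˡ 1# ⟩
    1#                ∎)
    where open CommutativeSemigroupProperties *-commutativeSemigroup using (interchange)

  IsUnit-*ˡ : ∀ {x y} → IsUnit (x * y) → IsUnit x
  IsUnit-*ˡ {x} {y} (w , xyw≈1) = y * w , trans (sym (*-assoc x y w)) xyw≈1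

  IsUnit-*ʳ : ∀ {x y} → IsUnit (x * y) → IsUnit y
  IsUnit-*ʳ {x} {y} xy-unit = IsUnit-*ˡ (IsUnit-resp (*-comm x y) xy-unit)

  prodFrom-IsUnit : ∀ a m (F : ℕ → Carrier) →
    (∀ l → a ≤ l → l < a ℕ.+ m → IsUnit (F l)) → IsUnit (prodFrom a m F)
  prodFrom-IsUnit a zero    F units = 1# , *-identityˡ 1#
  prodFrom-IsUnit a (suc m) F units = *-IsUnit
    (units a ≤-refl (m<m+n a (s≤s z≤n)))
    (prodFrom-IsUnit (suc a) m F (λ l a<l l<1+a+m →
      units l (<⇒≤ a<l) (<-≤-trans l<1+a+m (≤-reflexive (≡.sym (ℕₚ.+-suc a m))))))

  prodFrom-IsUnit⁻¹ : ∀ a m (F : ℕ → Carrier) →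
    IsUnit (prodFrom a m F) → ∀ l → a ≤ l → l < a ℕ.+ m → IsUnit (F l)
  prodFrom-IsUnit⁻¹ a zero    F _    l a≤l l<a+0 =
    ⊥-elim (<-irrefl ≡.refl (<-≤-trans l<a+0 (≤-trans (≤-reflexive (ℕₚ.+-identityʳ a)) a≤l)))
  prodFrom-IsUnit⁻¹ a (suc m) F unit l a≤l l<a+1+m with m≤n⇒m<n∨m≡n a≤l
  ... | inj₂ ≡.refl = IsUnit-*ˡ unit
  ... | inj₁ a<l  = prodFrom-IsUnit⁻¹ (suc a) m F (IsUnit-*ʳ unit) l a<l (<-≤-trans l<a+1+m (≤-reflexive (ℕₚ.+-suc a m)))

  lower-triangular-solvable : ∀ t (M : ℕ → ℕ → Carrier) (d : ℕ → Carrier) →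
    (∀ s → s < t → IsUnit (M s s)) →
    Σ (ℕ → Carrier) λ y → ∀ s → s < t → ∑< (suc s) (λ j → M s j * y j) ≈ d s
  lower-triangular-solvable zero    M d units = (λ _ → 0#) , λ _ ()
  lower-triangular-solvable (suc t) M d units = y′ , solves
    where
    previous = lower-triangular-solvable t M d (λ s s<t → units s (m<n⇒m<1+n s<t))
    y = proj₁ previous
    S = ∑< t (λ j → M t j * y j)
    u = proj₁ (units t (n<1+n t))

    y′ : ℕ → Carrier
    y′ j = if j ≡ᵇ t then u * (d t - S) else y j

    y′-below : ∀ j → j < t → y′ j ≡ y j
    y′-below j j<t = ≡.cong (λ b → if b then u * (d t - S) else y j) (<⇒≡ᵇ-false j<t)

    y′-top : y′ t ≡ u * (d t - S)
    y′-top = ≡.cong (λ b → if b then u * (d t - S) else y t) (≡ᵇ-refl t)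

    y′≈y : ∀ s → s < t → ∑< (suc s) (λ j → M s j * y′ j) ≈ ∑< (suc s) (λ j → M s j * y j)
    y′≈y s s<t = ∑<-cong (suc s) (λ j j≤s → *-congˡ {M s j} (≡⇒≈ (y′-below j (<-≤-trans j≤s s<t))))

    solves : ∀ s → s < suc t → ∑< (suc s) (λ j → M s j * y′ j) ≈ d s
    solves s s<1+t with m<1+n⇒m<n∨m≡n s<1+t
    ... | inj₁ s<t    = trans (y′≈y s s<t) (proj₂ previous s s<t)
    ... | inj₂ ≡.refl = begin
      ∑< (suc t) (λ j → M t j * y′ j)        ≈⟨ ∑<-suc t (λ j → M t j * y′ j) ⟩
      ∑< t (λ j → M t j * y′ j) + M t t * y′ t
        ≈⟨ +-cong (∑<-cong t (λ j j<t → *-congˡ {M t j} (≡⇒≈ (y′-below j j<t))))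
                  (*-congˡ {M t t} (≡⇒≈ y′-top)) ⟩
      S + M t t * (u * (d t - S))            ≈⟨ +-congˡ (sym (*-assoc _ _ _)) ⟩
      S + (M t t * u) * (d t - S)            ≈⟨ +-congˡ (trans (*-congʳ (proj₂ (units t (n<1+n t)))) (*-identityˡ _)) ⟩
      S + (d t - S)                          ≈⟨ trans (sym (+-assoc S (d t) (- S))) (xyx⁻¹≈y S (d t)) ⟩
      d t                                    ∎

module ΔTPowers {c ℓ : Level} (R : CommutativeRing c ℓ) (lam : CommutativeRing.Carrier R) where
  open CommutativeRing R
  open Sums R
  open SetoidReasoning setoid
  open NaturalSolver commutativeSemiring using (solve; _:+_; _:*_; _:=_)

  -- binom l lists the coefficients of (1 + λT)^l.
  binom : ℕ → ℕ → Carrier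
  binom l k = fromℕ (l C k) * pow lam k

  binom-0 : ∀ l → binom l 0 ≈ 1#
  binom-0 l = trans (*-identityʳ _) (+-identityʳ 1#)

  binom-vanish : ∀ {l k} → l < k → binom l k ≈ 0#
  binom-vanish l<k = trans (*-congʳ (≡⇒≈ (≡.cong fromℕ (k>n⇒nCk≡0 l<k)))) (zeroˡ _)

  binom-suc : ∀ l k → binom (suc l) k ≈ binom l k + lam * shift 1 (binom l) k
  binom-suc l zero    = sym (trans (+-congˡ (zeroʳ lam)) (+-identityʳ _))
  binom-suc l (suc k) = begin
    fromℕ (suc l C suc k) * (lam * pow lam k)
      ≈⟨ *-congʳ (trans (≡⇒≈ (≡.cong fromℕ (≡.sym (nCk+nC[k+1]≡[n+1]C[k+1] l k)))) (fromℕ-+ (l C k) (l C suc k))) ⟩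
    (fromℕ (l C k) + fromℕ (l C suc k)) * (lam * pow lam k)
      ≈⟨ solve 4 (λ x y z p → (x :+ y) :* (z :* p) := y :* (z :* p) :+ z :* (x :* p)) refl
               (fromℕ (l C k)) (fromℕ (l C suc k)) lam (pow lam k) ⟩
    binom l (suc k) + lam * binom l k ∎

  -- Arrays F i j are coefficients of T^i ⊗ T^j in R[T, T′], with no truncation; mulΔT is
  -- multiplication by ΔT = T ⊗ 1 + 1 ⊗ T + λ T ⊗ T, and ΔTpow s is ΔT^s.
  mulΔT : (ℕ → ℕ → Carrier) → ℕ → ℕ → Carrier
  mulΔT F i j = (shift² 1 0 F i j + shift² 0 1 F i j) + lam * shift² 1 1 F i j

  ΔTpow : ℕ → ℕ → ℕ → Carrier
  ΔTpow zero    i j = if (i ≡ᵇ 0) ∧ (j ≡ᵇ 0) then 1# else 0#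
  ΔTpow (suc s)     = mulΔT (ΔTpow s)

  shift-binom-suc : ∀ m l i → shift m (binom (suc l)) i ≈ shift m (binom l) i + lam * shift (suc m) (binom l) i
  shift-binom-suc m l i = begin
    shift m (binom (suc l)) i                                  ≈⟨ shift-cong m (binom-suc l) i ⟩
    shift m (λ k → binom l k + lam * shift 1 (binom l) k) i    ≈⟨ shift-+ m (binom l) _ i ⟩
    shift m (binom l) i + shift m (λ k → lam * shift 1 (binom l) k) i
      ≈⟨ +-congˡ (trans (shift-*ˡ m lam (shift 1 (binom l)) i) (*-congˡ (≡⇒≈ (shift-suc m (binom l) i)))) ⟩
    shift m (binom l) i + lam * shift (suc m) (binom l) i ∎

  -- Truncated subtraction breaks suc (s ∸ suc l) ≡ s ∸ l when s ≤ l, but then the coefficient vanishes.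
  C*shift-∸-suc : ∀ s l (G : ℕ → Carrier) i →
    fromℕ (s C suc l) * shift (suc (s ∸ suc l)) G i ≈ fromℕ (s C suc l) * shift (s ∸ l) G i
  C*shift-∸-suc s l G i with l ℕ.<? s
  ... | yes l<s = ≡⇒≈ (≡.cong (λ m → fromℕ (s C suc l) * shift m G i) (≡.sym (+-∸-assoc 1 l<s)))
  ... | no  l≮s = trans (*-congʳ zero-coefficient) (trans (zeroˡ _) (sym (trans (*-congʳ zero-coefficient) (zeroˡ _))))
    where
    zero-coefficient : fromℕ (s C suc l) ≈ 0#
    zero-coefficient = ≡⇒≈ (≡.cong fromℕ (k>n⇒nCk≡0 (s≤s (≮⇒≥ l≮s))))

  ΔTpow-closed-form : ∀ s l i → ΔTpow s i l ≈ fromℕ (s C l) * shift (s ∸ l) (binom l) i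
  ΔTpow-closed-form zero    zero    zero    = sym (trans (*-congʳ (+-identityʳ 1#)) (trans (*-identityˡ _) (binom-0 0)))
  ΔTpow-closed-form zero    zero    (suc i) = sym (trans (*-congˡ (binom-vanish {0} {suc i} (s≤s z≤n))) (zeroʳ _))
  ΔTpow-closed-form zero    (suc l) zero    = sym (zeroˡ _)
  ΔTpow-closed-form zero    (suc l) (suc i) = sym (zeroˡ _)
  ΔTpow-closed-form (suc s) zero    i       = begin
    (shift 1 (λ a → ΔTpow s a 0) i + 0#) + lam * shift 1 (λ _ → 0#) i
      ≈⟨ trans (+-cong (+-identityʳ _) (trans (*-congˡ (≡⇒≈ (shift-0 1 i))) (zeroʳ lam))) (+-identityʳ _) ⟩
    shift 1 (λ a → ΔTpow s a 0) i                  ≈⟨ shift-1-scaled (fromℕ (s C 0)) s (binom 0) (ΔTpow-closed-form s 0) i ⟩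
    fromℕ (suc s C 0) * shift (suc s) (binom 0) i ∎
  ΔTpow-closed-form (suc s) (suc l) i = begin
    (shift 1 (λ a → ΔTpow s a (suc l)) i + ΔTpow s i l) + lam * shift 1 (λ a → ΔTpow s a l) i
      ≈⟨ +-cong (+-cong (trans (shift-1-scaled c₁ (s ∸ suc l) (binom (suc l)) (ΔTpow-closed-form s (suc l)) i)
                                (C*shift-∸-suc s l (binom (suc l)) i))
                        (ΔTpow-closed-form s l i))
                (*-congˡ (shift-1-scaled c₀ m (binom l) (ΔTpow-closed-form s l) i)) ⟩
    (c₁ * P′ + c₀ * P) + lam * (c₀ * Q)
      ≈⟨ solve 6 (λ c₁ P′ c₀ P λ′ Q → (c₁ :* P′ :+ c₀ :* P) :+ λ′ :* (c₀ :* Q)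
                                    := c₁ :* P′ :+ c₀ :* (P :+ λ′ :* Q)) refl
               c₁ P′ c₀ P lam Q ⟩
    c₁ * P′ + c₀ * (P + lam * Q)
      ≈⟨ +-congˡ (*-congˡ (sym (shift-binom-suc m l i))) ⟩
    c₁ * P′ + c₀ * P′
      ≈⟨ trans (+-comm _ _) (sym (distribʳ P′ c₀ c₁)) ⟩
    (c₀ + c₁) * P′
      ≈⟨ *-congʳ (trans (sym (fromℕ-+ (s C l) (s C suc l))) (≡⇒≈ (≡.cong fromℕ (nCk+nC[k+1]≡[n+1]C[k+1] s l)))) ⟩
    fromℕ (suc s C suc l) * P′ ∎
    where
    m  = s ∸ l
    c₀ = fromℕ (s C l)
    c₁ = fromℕ (s C suc l)
    P  = shift m (binom l) i
    P′ = shift m (binom (suc l)) i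
    Q  = shift (suc m) (binom l) i

  ΔTpow-vanish : ∀ {s l} i → s < l → ΔTpow s i l ≈ 0#
  ΔTpow-vanish {s} {l} i s<l =
    trans (ΔTpow-closed-form s l i) (x≈0⇒x*y≈0 (≡⇒≈ (≡.cong fromℕ (k>n⇒nCk≡0 s<l))))

  mulΔT-cong : ∀ {F G : ℕ → ℕ → Carrier} → (∀ a b → F a b ≈ G a b) → ∀ i j → mulΔT F i j ≈ mulΔT G i j
  mulΔT-cong F≈G i j =
    +-cong (+-cong (shift²-cong 1 0 F≈G i j) (shift²-cong 0 1 F≈G i j)) (*-congˡ (shift²-cong 1 1 F≈G i j))

  mulΔT-sym : ∀ {F : ℕ → ℕ → Carrier} → (∀ a b → F a b ≈ F b a) → ∀ i j → mulΔT F i j ≈ mulΔT F j i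
  mulΔT-sym {F} F-sym i j = +-cong
    (trans (+-cong (shift-cong 1 (λ a → F-sym a j) i) (shift-cong 1 (λ b → F-sym i b) j)) (+-comm _ _))
    (*-congˡ (trans (shift²-comm 1 1 F i j) (shift²-cong 1 1 (λ b a → F-sym a b) j i)))

  ΔTpow-sym : ∀ s i j → ΔTpow s i j ≈ ΔTpow s j i
  ΔTpow-sym zero    zero    zero    = refl
  ΔTpow-sym zero    zero    (suc j) = refl
  ΔTpow-sym zero    (suc i) zero    = refl
  ΔTpow-sym zero    (suc i) (suc j) = refl
  ΔTpow-sym (suc s) i       j       = mulΔT-sym (ΔTpow-sym s) i j

  mulΔT-∑< : ∀ m (c : ℕ → Carrier) (F : ℕ → ℕ → ℕ → Carrier) i j →
    ∑< m (λ t → c t * mulΔT (F t) i j) ≈ mulΔT (λ a b → ∑< m (λ t → c t * F t a b)) i j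
  mulΔT-∑< m c F i j = begin
    ∑< m (λ t → c t * ((A t + B t) + lam * C t))
      ≈⟨ ∑<-cong m (λ t _ → solve 5 (λ c A B λ′ C → c :* ((A :+ B) :+ λ′ :* C)
                                                 := (c :* A :+ c :* B) :+ λ′ :* (c :* C)) refl
                                    (c t) (A t) (B t) lam (C t)) ⟩
    ∑< m (λ t → (c t * A t + c t * B t) + lam * (c t * C t))
      ≈⟨ ∑<-combination m (λ t → c t * A t) (λ t → c t * B t) (λ t → c t * C t) lam ⟩
    (∑< m (λ t → c t * A t) + ∑< m (λ t → c t * B t)) + lam * ∑< m (λ t → c t * C t)
      ≈⟨ sym (+-cong (+-cong (shift²-∑< 1 0 m c F i j) (shift²-∑< 0 1 m c F i j)) (*-congˡ (shift²-∑< 1 1 m c F i j))) ⟩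
    mulΔT (λ a b → ∑< m (λ t → c t * F t a b)) i j ∎
    where
    A B C : ℕ → Carrier
    A t = shift² 1 0 (F t) i j
    B t = shift² 0 1 (F t) i j
    C t = shift² 1 1 (F t) i j

  onePlusλΔT-outer : ∀ (x y : ℕ → Carrier) i j →
    x i * y j + lam * mulΔT (λ a b → x a * y b) i j ≈ (x i + lam * shift 1 x i) * (y j + lam * shift 1 y j)
  onePlusλΔT-outer x y i j = begin
    x i * y j + lam * mulΔT (λ a b → x a * y b) i j
      ≈⟨ +-congˡ (*-congˡ (+-cong (+-cong (shift-*ʳ 1 (y j) x i) (shift-*ˡ 1 (x i) y j))
                                  (*-congˡ (trans (shift-cong 1 (λ a → shift-*ˡ 1 (x a) y j) i) (shift-*ʳ 1 (shift 1 y j) x i))))) ⟩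
    x i * y j + lam * ((x′ * y j + x i * y′) + lam * (x′ * y′))
      ≈⟨ solve 5 (λ x y x′ y′ λ′ → x :* y :+ λ′ :* ((x′ :* y :+ x :* y′) :+ λ′ :* (x′ :* y′))
                                 := (x :+ λ′ :* x′) :* (y :+ λ′ :* y′)) refl
               (x i) (y j) x′ y′ lam ⟩
    (x i + lam * x′) * (y j + lam * y′) ∎
    where
    x′ = shift 1 x i
    y′ = shift 1 y j

  powOnePlusλΔT : ℕ → ℕ → ℕ → Carrier
  powOnePlusλΔT l i j = ∑< (suc l) (λ t → binom l t * ΔTpow t i j)

  powOnePlusλΔT-suc : ∀ l i j → powOnePlusλΔT (suc l) i j ≈ powOnePlusλΔT l i j + lam * mulΔT (powOnePlusλΔT l) i j
  powOnePlusλΔT-suc l i j = begin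
    ∑< (suc (suc l)) (λ t → binom (suc l) t * ΔTpow t i j)
      ≈⟨ ∑<-cong (suc (suc l)) (λ t _ → trans (*-congʳ (binom-suc l t))
                                             (trans (distribʳ (ΔTpow t i j) _ _) (+-congˡ (*-assoc lam _ _)))) ⟩
    ∑< (suc (suc l)) (λ t → binom l t * ΔTpow t i j + lam * (shift 1 (binom l) t * ΔTpow t i j))
      ≈⟨ trans (∑<-+ (suc (suc l)) (λ t → binom l t * ΔTpow t i j) (λ t → lam * (shift 1 (binom l) t * ΔTpow t i j)))
               (+-congˡ (sym (∑<-*ˡ (suc (suc l)) lam (λ t → shift 1 (binom l) t * ΔTpow t i j)))) ⟩
    ∑< (suc (suc l)) (λ t → binom l t * ΔTpow t i j)
      + lam * (0# * ΔTpow 0 i j + ∑< (suc l) (λ t → binom l t * ΔTpow (suc t) i j))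
      ≈⟨ +-cong (∑<-truncate (λ t → binom l t * ΔTpow t i j) (n≤1+n (suc l)) (λ t l<t → x≈0⇒x*y≈0 (binom-vanish l<t)))
                (*-congˡ (trans (+-cong (zeroˡ _) (mulΔT-∑< (suc l) (binom l) ΔTpow i j)) (+-identityˡ _))) ⟩
    powOnePlusλΔT l i j + lam * mulΔT (powOnePlusλΔT l) i j ∎

  ΔTpow-0-outer : ∀ i j → ΔTpow 0 i j ≈ binom 0 i * binom 0 j
  ΔTpow-0-outer zero    zero    = sym (trans (*-cong (binom-0 0) (binom-0 0)) (*-identityˡ 1#))
  ΔTpow-0-outer zero    (suc j) = sym (trans (*-congˡ (binom-vanish {0} {suc j} (s≤s z≤n))) (zeroʳ _))
  ΔTpow-0-outer (suc i) j       = sym (trans (*-congʳ (binom-vanish {0} {suc i} (s≤s z≤n))) (zeroˡ _))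

  powOnePlusλΔT-outer : ∀ l i j → powOnePlusλΔT l i j ≈ binom l i * binom l j
  powOnePlusλΔT-outer zero    i j = trans (+-identityʳ _) (trans (*-congʳ (binom-0 0)) (trans (*-identityˡ _) (ΔTpow-0-outer i j)))
  powOnePlusλΔT-outer (suc l) i j = begin
    powOnePlusλΔT (suc l) i j                                     ≈⟨ powOnePlusλΔT-suc l i j ⟩
    powOnePlusλΔT l i j + lam * mulΔT (powOnePlusλΔT l) i j
      ≈⟨ +-cong (powOnePlusλΔT-outer l i j) (*-congˡ (mulΔT-cong (powOnePlusλΔT-outer l) i j)) ⟩
    binom l i * binom l j + lam * mulΔT (λ a b → binom l a * binom l b) i j ≈⟨ onePlusλΔT-outer (binom l) (binom l) i j ⟩
    (binom l i + lam * shift 1 (binom l) i) * (binom l j + lam * shift 1 (binom l) j)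
      ≈⟨ sym (*-cong (binom-suc l i) (binom-suc l j)) ⟩
    binom (suc l) i * binom (suc l) j ∎

module Coproduct {c ℓ a ℓa : Level} (R : CommutativeRing c ℓ) (A : CommutativeRing a ℓa)
    (ι : CommutativeRing.Carrier R → CommutativeRing.Carrier A)
    (lam : CommutativeRing.Carrier R) (N : ℕ) (1<N : 1 < N) where

  open GroupAlgebra R A ι lam N
  open ΔTPowers R lam
  private module ΣR = Sums R
  open SetoidReasoning R.setoid

  0<N : 0 < N
  0<N = <-trans (s≤s z≤n) 1<N

  _≋_ : H⊗H → (ℕ → ℕ → R.Carrier) → Set ℓ
  x ≋ F = ∀ a b → x a b R.≈ F (toℕ a) (toℕ b)

  -- kernel F u v i j is the coefficient of T^i ⊗ T^j in (T^u ⊗ T^v) · F, with F cut off at indices N.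
  kernel : (ℕ → ℕ → R.Carrier) → ℕ → ℕ → ℕ → ℕ → R.Carrier
  kernel F u v i j = ΣR.∑< N (λ a → ΣR.∑< N (λ b → if (u ℕ.+ a ≡ᵇ i) ∧ (v ℕ.+ b ≡ᵇ j) then F a b else R.0#))

  *⊗-kernel : ∀ x y {F} → y ≋ F → ∀ i j →
    (x *⊗ y) i j R.≈ OR.sumFin N (λ a → OR.sumFin N (λ b → x a b R.* kernel F (toℕ a) (toℕ b) (toℕ i) (toℕ j)))
  *⊗-kernel x y y≋F i j =
    ΣR.sumFin-cong N λ a → ΣR.sumFin-cong N λ b → R.sym (R.trans (ΣR.sumFin-*ˡ N (x a b) _)
      (ΣR.sumFin-cong N λ a′ → R.trans (ΣR.sumFin-*ˡ N (x a b) _)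
        (ΣR.sumFin-cong N λ b′ → R.trans (R.sym (ΣR.if0-*ˡ (cond a b a′ b′) (x a b) _))
                                        (ΣR.if0-cong (cond a b a′ b′) (R.*-congˡ (R.sym (y≋F a′ b′)))))))
    where
    cond : Fin N → Fin N → Fin N → Fin N → Bool
    cond a b a′ b′ = (toℕ a ℕ.+ toℕ a′ ≡ᵇ toℕ i) ∧ (toℕ b ℕ.+ toℕ b′ ≡ᵇ toℕ j)

  ΔT-*⊗ : ∀ y {F} → y ≋ F → (ΔT *⊗ y) ≋ mulΔT F
  ΔT-*⊗ y {F} y≋F i j = begin
    (ΔT *⊗ y) i j
      ≈⟨ *⊗-kernel ΔT y {F} y≋F i j ⟩
    ΣR.∑< N (λ a → ΣR.∑< N (λ b → ((δ 1 0 a b R.+ δ 0 1 a b) R.+ lam R.* δ 1 1 a b) R.* K a b))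
      ≈⟨ ΣR.∑<-cong N (λ a _ → ΣR.∑<-cong N (λ b _ →
           R.trans (R.distribʳ (K a b) (δ 1 0 a b R.+ δ 0 1 a b) (lam R.* δ 1 1 a b))
                   (R.+-cong (R.distribʳ (K a b) (δ 1 0 a b) (δ 0 1 a b)) (R.*-assoc lam (δ 1 1 a b) (K a b))))) ⟩
    ΣR.∑< N (λ a → ΣR.∑< N (λ b → (δK 1 0 a b R.+ δK 0 1 a b) R.+ lam R.* δK 1 1 a b))
      ≈⟨ ΣR.∑<-cong N (λ a _ → ΣR.∑<-combination N (δK 1 0 a) (δK 0 1 a) (δK 1 1 a) lam) ⟩
    ΣR.∑< N (λ a → (ΣR.∑< N (δK 1 0 a) R.+ ΣR.∑< N (δK 0 1 a)) R.+ lam R.* ΣR.∑< N (δK 1 1 a))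
      ≈⟨ ΣR.∑<-combination N (λ a → ΣR.∑< N (δK 1 0 a)) (λ a → ΣR.∑< N (δK 0 1 a))
                              (λ a → ΣR.∑< N (δK 1 1 a)) lam ⟩
    (∑²δK 1 0 R.+ ∑²δK 0 1) R.+ lam R.* ∑²δK 1 1
      ≈⟨ R.+-cong (R.+-cong (at 1 0 1<N 0<N) (at 0 1 0<N 1<N)) (R.*-congˡ (at 1 1 1<N 1<N)) ⟩
    mulΔT F (toℕ i) (toℕ j) ∎
    where
    K : ℕ → ℕ → R.Carrier
    K a b = kernel F a b (toℕ i) (toℕ j)
    δ : ℕ → ℕ → ℕ → ℕ → R.Carrier
    δ u v a b = if (a ≡ᵇ u) ∧ (b ≡ᵇ v) then R.1# else R.0#
    δK : ℕ → ℕ → ℕ → ℕ → R.Carrier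
    δK u v a b = δ u v a b R.* K a b
    ∑²δK : ℕ → ℕ → R.Carrier
    ∑²δK u v = ΣR.∑< N (λ a → ΣR.∑< N (δK u v a))
    at : ∀ u v → u < N → v < N → ∑²δK u v R.≈ ΣR.shift² u v F (toℕ i) (toℕ j)
    at u v u<N v<N = R.trans (ΣR.∑<²-indicator K u<N v<N) (ΣR.∑<²-indicator-shift u v F (Finₚ.toℕ<n i) (Finₚ.toℕ<n j))

  pow⊗-ΔT : ∀ s → pow⊗ ΔT s ≋ ΔTpow s
  pow⊗-ΔT zero    a b = R.refl
  pow⊗-ΔT (suc s)     = ΔT-*⊗ (pow⊗ ΔT s) (pow⊗-ΔT s)

  Δ_H-expansion : ∀ h a b → Δ_H h a b R.≈ OR.sumFin N (λ s → h s R.* ΔTpow (toℕ s) (toℕ a) (toℕ b))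
  Δ_H-expansion h a b = ΣR.sumFin-cong N (λ s → R.*-congˡ (pow⊗-ΔT (toℕ s) a b))

  Δ_H-e : ∀ {s} → s < N → Δ_H (e s) ≋ ΔTpow s
  Δ_H-e {s} s<N a b = R.trans (Δ_H-expansion (e s) a b) (R.trans
    (ΣR.∑<-cong N (λ t _ → ΣR.if01-* (t ≡ᵇ s) (ΔTpow t (toℕ a) (toℕ b))))
    (ΣR.∑<-indicator (λ t → ΔTpow t (toℕ a) (toℕ b)) s<N))

  grouplike : ℕ → H
  grouplike l i = binom l (toℕ i)

  Δ_H-grouplike : ∀ {l} → l < N → Δ_H (grouplike l) ≋ λ i j → binom l i R.* binom l j
  Δ_H-grouplike {l} l<N a b = begin
    Δ_H (grouplike l) a b                                         ≈⟨ Δ_H-expansion (grouplike l) a b ⟩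
    ΣR.∑< N (λ t → binom l t R.* ΔTpow t (toℕ a) (toℕ b))
      ≈⟨ ΣR.∑<-truncate (λ t → binom l t R.* ΔTpow t (toℕ a) (toℕ b)) l<N
                        (λ t l<t → ΣR.x≈0⇒x*y≈0 (binom-vanish l<t)) ⟩
    powOnePlusλΔT l (toℕ a) (toℕ b)                              ≈⟨ powOnePlusλΔT-outer l (toℕ a) (toℕ b) ⟩
    binom l (toℕ a) R.* binom l (toℕ b)                          ∎

  Δ_H-sym : ∀ h a b → Δ_H h a b R.≈ Δ_H h b a
  Δ_H-sym h a b = R.trans (Δ_H-expansion h a b) (R.trans
    (ΣR.sumFin-cong N (λ s → R.*-congˡ (ΔTpow-sym (toℕ s) (toℕ a) (toℕ b))))
    (R.sym (Δ_H-expansion h b a)))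

  Δ_H-cong : ∀ {h h′} → h ≈H h′ → ∀ a b → Δ_H h a b R.≈ Δ_H h′ a b
  Δ_H-cong h≈h′ a b = ΣR.sumFin-cong N (λ s → R.*-congʳ (h≈h′ s))

  Δ_H-+ : ∀ h h′ a b → Δ_H (h +H h′) a b R.≈ Δ_H h a b R.+ Δ_H h′ a b
  Δ_H-+ h h′ a b = R.trans (ΣR.sumFin-cong N (λ s → R.distribʳ _ _ _)) (ΣR.sumFin-+ N _ _)

  Δ_H-• : ∀ r h a b → Δ_H (r •H h) a b R.≈ r R.* Δ_H h a b
  Δ_H-• r h a b = R.trans (ΣR.sumFin-cong N (λ s → R.*-assoc _ _ _)) (R.sym (ΣR.sumFin-*ˡ N r _))

module Coordinates {c ℓ a ℓa : Level} (R : CommutativeRing c ℓ) (A : CommutativeRing a ℓa)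
    (ι : CommutativeRing.Carrier R → CommutativeRing.Carrier A) (ι-hom : IsAlgebraMap R A ι)
    (lam : CommutativeRing.Carrier R) (N : ℕ) where

  open GroupAlgebra R A ι lam N
  open RingMorphisms.IsRingHomomorphism ι-hom public
  open ΔTPowers R lam using (binom)
  private
    module ΣR = Sums R
    module ΣA = Sums A
  open A using (_≈_; 0#; 1#; _*_)
  open SetoidReasoning A.setoid

  ι-fromℕ : ∀ m → ι (OR.fromℕ m) ≈ OA.fromℕ m
  ι-fromℕ zero    = 0#-homo
  ι-fromℕ (suc m) = A.trans (+-homo _ _) (A.+-cong 1#-homo (ι-fromℕ m))

  ι-pow : ∀ x k → ι (OR.pow x k) ≈ OA.pow (ι x) k
  ι-pow x zero    = 1#-homo
  ι-pow x (suc k) = A.trans (*-homo _ _) (A.*-congˡ (ι-pow x k))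

  ι-if01 : ∀ b → ι (if b then R.1# else R.0#) ≈ (if b then 1# else 0#)
  ι-if01 true  = 1#-homo
  ι-if01 false = 0#-homo

  ι-≈0 : ∀ {x} → x R.≈ R.0# → ι x ≈ 0#
  ι-≈0 x≈0 = A.trans (⟦⟧-cong x≈0) 0#-homo

  ι-binom : ∀ l k → ι (binom l k) ≈ OA.fromℕ (l C k) * OA.pow (ι lam) k
  ι-binom l k = A.trans (*-homo _ _) (A.*-cong (ι-fromℕ (l C k)) (ι-pow lam k))

  fun-zero : ∀ (f : Lin) → fun f (λ _ → R.0#) ≈ 0#
  fun-zero f = begin
    fun f (λ _ → R.0#)               ≈⟨ cong f (λ _ → R.sym (R.zeroˡ R.0#)) ⟩
    fun f (R.0# •H (λ _ → R.0#))     ≈⟨ •-lin f R.0# _ ⟩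
    ι R.0# * fun f (λ _ → R.0#)      ≈⟨ A.trans (A.*-congʳ 0#-homo) (A.zeroˡ _) ⟩
    0#                               ∎

  fun-sumFin : ∀ (f : Lin) m (φ : Fin m → H) → fun f (λ k → OR.sumFin m (λ i → φ i k)) ≈ OA.sumFin m (λ i → fun f (φ i))
  fun-sumFin f zero    φ = fun-zero f
  fun-sumFin f (suc m) φ = A.trans (+-lin f (φ Fin.zero) _) (A.+-congˡ (fun-sumFin f m (λ i → φ (Fin.suc i))))

  basis-expansion : ∀ (h : H) → h ≈H (λ k → OR.sumFin N (λ i → (h i •H e (toℕ i)) k))
  basis-expansion h k = R.sym (R.trans (ΣR.sumFin-cong N term) (ΣR.sumFin-indicator k h))
    where
    term : ∀ i → h i R.* (if toℕ k ≡ᵇ toℕ i then R.1# else R.0#) R.≈ (if toℕ i ≡ᵇ toℕ k then h i else R.0#)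
    term i = R.trans (R.*-comm _ _) (R.trans (ΣR.if01-* (toℕ k ≡ᵇ toℕ i) (h i))
                     (ΣR.≡⇒≈ (≡.cong (λ b → if b then h i else R.0#) (≡ᵇ-sym (toℕ k) (toℕ i)))))

  fun-coordinates : ∀ (f : Lin) h → fun f h ≈ OA.sumFin N (λ i → ι (h i) * X f (toℕ i))
  fun-coordinates f h = begin
    fun f h                                                  ≈⟨ cong f (basis-expansion h) ⟩
    fun f (λ k → OR.sumFin N (λ i → (h i •H e (toℕ i)) k))   ≈⟨ fun-sumFin f N (λ i → h i •H e (toℕ i)) ⟩
    OA.sumFin N (λ i → fun f (h i •H e (toℕ i)))             ≈⟨ ΣA.sumFin-cong N (λ i → •-lin f (h i) (e (toℕ i))) ⟩
    OA.sumFin N (λ i → ι (h i) * X f (toℕ i))                ∎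

  Lin-ext : ∀ (f g : Lin) → (∀ s → s < N → X f s ≈ X g s) → ∀ h → fun f h ≈ fun g h
  Lin-ext f g f≈g h = begin
    fun f h                                    ≈⟨ fun-coordinates f h ⟩
    OA.sumFin N (λ i → ι (h i) * X f (toℕ i))  ≈⟨ ΣA.sumFin-cong N (λ i → A.*-congˡ (f≈g (toℕ i) (Finₚ.toℕ<n i))) ⟩
    OA.sumFin N (λ i → ι (h i) * X g (toℕ i))  ≈⟨ fun-coordinates g h ⟨
    fun g h                                    ∎

  X-vanish : ∀ (f : Lin) {k} → N ≤ k → X f k ≈ 0#
  X-vanish f N≤k = A.trans
    (cong f (λ i → ΣR.≡⇒≈ (≡.cong (λ b → if b then R.1# else R.0#)
                                  (<⇒≡ᵇ-false (<-≤-trans (Finₚ.toℕ<n i) N≤k)))))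
    (fun-zero f)

  fromCoordinates : (Fin N → A.Carrier) → Lin
  fromCoordinates v = record
    { fun   = λ h → OA.sumFin N (λ i → ι (h i) * v i)
    ; cong  = λ h≈h′ → ΣA.sumFin-cong N (λ i → A.*-congʳ (⟦⟧-cong (h≈h′ i)))
    ; +-lin = λ h h′ → A.trans (ΣA.sumFin-cong N (λ i → A.trans (A.*-congʳ (+-homo _ _)) (A.distribʳ _ _ _)))
                               (ΣA.sumFin-+ N _ _)
    ; •-lin = λ r h → A.trans (ΣA.sumFin-cong N (λ i → A.trans (A.*-congʳ (*-homo _ _)) (A.*-assoc _ _ _)))
                              (A.sym (ΣA.sumFin-*ˡ N (ι r) _))
    }

  X-fromCoordinates : ∀ v (k : Fin N) → X (fromCoordinates v) (toℕ k) ≈ v k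
  X-fromCoordinates v k = A.trans
    (ΣA.sumFin-cong N (λ i → A.trans (A.*-congʳ (ι-if01 (toℕ i ≡ᵇ toℕ k))) (ΣA.if01-* (toℕ i ≡ᵇ toℕ k) (v i))))
    (ΣA.sumFin-indicator k v)

module Convolution {c ℓ a ℓa : Level} (R : CommutativeRing c ℓ) (A : CommutativeRing a ℓa)
    (ι : CommutativeRing.Carrier R → CommutativeRing.Carrier A) (ι-hom : IsAlgebraMap R A ι)
    (lam : CommutativeRing.Carrier R) (N : ℕ) (1<N : 1 < N) where

  open GroupAlgebra R A ι lam N
  open ΔTPowers R lam
  open Coproduct R A ι lam N 1<N
  open Coordinates R A ι ι-hom lam N
  private
    module ΣR = Sums R
    module ΣA = Sums A
    module UA = Units A
  open A using (_≈_; _+_; _*_; 0#; 1#)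
  open SetoidReasoning A.setoid

  -- The coefficient of X_{T^j}(g) in X_{T^s}(f * g).
  convCoefficient : Lin → ℕ → ℕ → A.Carrier
  convCoefficient f s j = ΣA.∑< N (λ i → ι (ΔTpow s i j) * X f i)

  -- f (T^m (1 + λT)^l), in the form of the product formula.
  shiftedBinomialValue : Lin → ℕ → ℕ → A.Carrier
  shiftedBinomialValue f m l = OA.sumUpTo (suc l) (λ k → OA.fromℕ (l C k) * (OA.pow (ι lam) k * X f (k ℕ.+ m)))

  shiftedBinomial-coordinates : ∀ (f : Lin) m {l} → l < N →
    ΣA.∑< N (λ i → ι (ΣR.shift m (binom l) i) * X f i) ≈ shiftedBinomialValue f m l
  shiftedBinomial-coordinates f m {l} l<N = begin
    ΣA.∑< N G
      ≈⟨ ΣA.∑<-truncate G (m≤n+m N m) (λ k N≤k → ΣA.y≈0⇒x*y≈0 (X-vanish f N≤k)) ⟨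
    ΣA.∑< (m ℕ.+ N) G
      ≈⟨ ΣA.∑<-shift m N G (λ k k<m → ΣA.x≈0⇒x*y≈0 (ι-≈0 (ΣR.≡⇒≈ (ΣR.shift-below (binom l) k<m)))) ⟩
    ΣA.∑< N (λ k → G (m ℕ.+ k))
      ≈⟨ ΣA.∑<-cong N (λ k _ → A.*-cong (⟦⟧-cong (ΣR.≡⇒≈ (ΣR.shift-offset m (binom l) k)))
                                        (ΣA.≡⇒≈ (≡.cong (X f) (ℕₚ.+-comm m k)))) ⟩
    ΣA.∑< N (λ k → ι (binom l k) * X f (k ℕ.+ m))
      ≈⟨ ΣA.∑<-truncate (λ k → ι (binom l k) * X f (k ℕ.+ m)) l<N
                        (λ k l<k → ΣA.x≈0⇒x*y≈0 (ι-≈0 (binom-vanish l<k))) ⟩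
    ΣA.∑< (suc l) (λ k → ι (binom l k) * X f (k ℕ.+ m))
      ≈⟨ ΣA.∑<-cong (suc l) (λ k _ → A.trans (A.*-congʳ {X f (k ℕ.+ m)} (ι-binom l k))
                                             (A.*-assoc (OA.fromℕ (l C k)) _ _)) ⟩
    ΣA.∑< (suc l) (λ k → OA.fromℕ (l C k) * (OA.pow (ι lam) k * X f (k ℕ.+ m)))
      ≈⟨ ΣA.sumUpTo≈∑< (suc l) _ ⟨
    shiftedBinomialValue f m l ∎
    where
    G : ℕ → A.Carrier
    G i = ι (ΣR.shift m (binom l) i) * X f i

  convCoefficient-formula : ∀ (f : Lin) s {j} → j < N →
    convCoefficient f s j ≈ OA.fromℕ (s C j) * shiftedBinomialValue f (s ∸ j) j
  convCoefficient-formula f s {j} j<N = begin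
    ΣA.∑< N (λ i → ι (ΔTpow s i j) * X f i)
      ≈⟨ ΣA.∑<-cong N (λ i _ → A.trans (A.*-congʳ {X f i} (A.trans (⟦⟧-cong (ΔTpow-closed-form s j i)) (*-homo _ _)))
                                       (A.*-assoc (ι (OR.fromℕ (s C j))) _ _)) ⟩
    ΣA.∑< N (λ i → ι (OR.fromℕ (s C j)) * (ι (ΣR.shift (s ∸ j) (binom j) i) * X f i))
      ≈⟨ ΣA.∑<-*ˡ N (ι (OR.fromℕ (s C j))) (λ i → ι (ΣR.shift (s ∸ j) (binom j) i) * X f i) ⟨
    ι (OR.fromℕ (s C j)) * ΣA.∑< N (λ i → ι (ΣR.shift (s ∸ j) (binom j) i) * X f i)
      ≈⟨ A.*-cong (ι-fromℕ (s C j)) (shiftedBinomial-coordinates f (s ∸ j) j<N) ⟩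
    OA.fromℕ (s C j) * shiftedBinomialValue f (s ∸ j) j ∎

  convCoefficient-vanish : ∀ (f : Lin) {s j} → s < j → convCoefficient f s j ≈ 0#
  convCoefficient-vanish f {s} {j} s<j =
    ΣA.∑<-zero N (λ i _ → ΣA.x≈0⇒x*y≈0 {y = X f i} (ι-≈0 (ΔTpow-vanish i s<j)))

  conv-e : ∀ (f g : Lin) {s} → s < N → conv f g (e s) ≈ ΣA.∑< (suc s) (λ j → convCoefficient f s j * X g j)
  conv-e f g {s} s<N = begin
    conv f g (e s)
      ≈⟨ ΣA.sumFin-cong N (λ i → ΣA.sumFin-cong N (λ j →
           A.trans (A.*-congʳ (⟦⟧-cong (Δ_H-e s<N i j))) (A.sym (A.*-assoc _ _ _)))) ⟩
    ΣA.∑< N (λ i → ΣA.∑< N (λ j → (ι (ΔTpow s i j) * X f i) * X g j))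
      ≈⟨ ΣA.sumFin-comm N N _ ⟩
    ΣA.∑< N (λ j → ΣA.∑< N (λ i → (ι (ΔTpow s i j) * X f i) * X g j))
      ≈⟨ ΣA.sumFin-cong N (λ j → A.sym (ΣA.sumFin-*ʳ N (X g (toℕ j)) _)) ⟩
    ΣA.∑< N (λ j → convCoefficient f s j * X g j)
      ≈⟨ ΣA.∑<-truncate (λ j → convCoefficient f s j * X g j) s<N
                        (λ j s<j → ΣA.x≈0⇒x*y≈0 (convCoefficient-vanish f s<j)) ⟩
    ΣA.∑< (suc s) (λ j → convCoefficient f s j * X g j) ∎

  conv-e-formula : ∀ (f g : Lin) {s} → s < N → conv f g (e s) ≈ productFormula f g s
  conv-e-formula f g {s} s<N = begin
    conv f g (e s)                                              ≈⟨ conv-e f g s<N ⟩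
    ΣA.∑< (suc s) (λ j → convCoefficient f s j * X g j)
      ≈⟨ ΣA.∑<-cong (suc s) (λ j j≤s → A.trans (A.*-congʳ {X g j} (convCoefficient-formula f s (≤-<-trans (≤-pred j≤s) s<N)))
                                               (A.*-assoc _ _ _)) ⟩
    ΣA.∑< (suc s) (λ j → OA.fromℕ (s C j) * (shiftedBinomialValue f (s ∸ j) j * X g j))
      ≈⟨ ΣA.sumUpTo≈∑< (suc s) _ ⟨
    productFormula f g s ∎

  ε_H-value : ∀ (ĥ : ℕ → R.Carrier) → ε_H (λ i → ĥ (toℕ i)) R.≈ ĥ 0
  ε_H-value ĥ = ΣR.∑<-indicator ĥ 0<N

  one-e : ∀ s → one (e s) ≈ (if s ≡ᵇ 0 then 1# else 0#)
  one-e s = A.trans (⟦⟧-cong (ε_H-value (λ t → if t ≡ᵇ s then R.1# else R.0#)))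
                    (A.trans (ι-if01 (0 ≡ᵇ s)) (ΣA.≡⇒≈ (≡.cong (λ b → if b then 1# else 0#) (≡ᵇ-sym 0 s))))

  convLin : Lin → Lin → Lin
  convLin f g = record
    { fun   = conv f g
    ; cong  = λ h≈h′ → ΣA.sumFin-cong N λ i → ΣA.sumFin-cong N λ j → A.*-congʳ (⟦⟧-cong (Δ_H-cong h≈h′ i j))
    ; +-lin = λ h h′ → A.trans
        (ΣA.sumFin-cong N λ i → A.trans
          (ΣA.sumFin-cong N λ j → A.trans (A.*-congʳ (A.trans (⟦⟧-cong (Δ_H-+ h h′ i j)) (+-homo _ _))) (A.distribʳ _ _ _))
          (ΣA.sumFin-+ N _ _))
        (ΣA.sumFin-+ N _ _)
    ; •-lin = λ r h → A.trans
        (ΣA.sumFin-cong N λ i → A.trans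
          (ΣA.sumFin-cong N λ j → A.trans (A.*-congʳ (A.trans (⟦⟧-cong (Δ_H-• r h i j)) (*-homo _ _))) (A.*-assoc _ _ _))
          (A.sym (ΣA.sumFin-*ˡ N (ι r) _)))
        (A.sym (ΣA.sumFin-*ˡ N (ι r) _))
    }

  oneLin : Lin
  oneLin = record
    { fun   = one
    ; cong  = λ h≈h′ → ⟦⟧-cong (ΣR.sumFin-cong N (λ s → ΣR.if0-cong (toℕ s ≡ᵇ 0) (h≈h′ s)))
    ; +-lin = λ h h′ → A.trans
        (⟦⟧-cong (R.trans (ΣR.sumFin-cong N (λ s → ΣR.if0-+ (toℕ s ≡ᵇ 0) _ _)) (ΣR.sumFin-+ N _ _)))
        (+-homo _ _)
    ; •-lin = λ r h → A.trans
        (⟦⟧-cong (R.trans (ΣR.sumFin-cong N (λ s → ΣR.if0-*ˡ (toℕ s ≡ᵇ 0) r _)) (R.sym (ΣR.sumFin-*ˡ N r _))))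
        (*-homo _ _)
    }

  conv-comm : ∀ (f g : Lin) h → conv f g h ≈ conv g f h
  conv-comm f g h = A.trans
    (ΣA.sumFin-cong N (λ i → ΣA.sumFin-cong N (λ j → A.*-cong (⟦⟧-cong (Δ_H-sym h i j)) (A.*-comm _ _))))
    (ΣA.sumFin-comm N N _)

  -- f ((1 + λT)^l), the l-th factor of Disc f.
  discFactor : Lin → ℕ → A.Carrier
  discFactor f l = OA.sumUpTo (suc l) (λ k → OA.fromℕ (l C k) * (OA.pow (ι lam) k * X f k))

  discFactor-0 : ∀ (f : Lin) → discFactor f 0 ≈ X f 0
  discFactor-0 f = A.trans (A.+-identityˡ _) (A.trans (A.*-cong (A.+-identityʳ 1#) (A.*-identityˡ _)) (A.*-identityˡ _))

  shiftedBinomialValue-0 : ∀ (f : Lin) l → shiftedBinomialValue f 0 l ≈ discFactor f l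
  shiftedBinomialValue-0 f l =
    ΣA.sumUpTo-cong (suc l) (λ k → A.*-congˡ (A.*-congˡ (ΣA.≡⇒≈ (≡.cong (X f) (ℕₚ.+-identityʳ k)))))

  fun-grouplike : ∀ (f : Lin) {l} → l < N → fun f (grouplike l) ≈ discFactor f l
  fun-grouplike f {l} l<N =
    A.trans (fun-coordinates f (grouplike l)) (A.trans (shiftedBinomial-coordinates f 0 l<N) (shiftedBinomialValue-0 f l))

  conv-grouplike : ∀ (f g : Lin) {l} → l < N → conv f g (grouplike l) ≈ fun f (grouplike l) * fun g (grouplike l)
  conv-grouplike f g {l} l<N = begin
    conv f g (grouplike l)
      ≈⟨ ΣA.sumFin-cong N (λ i → ΣA.sumFin-cong N (λ j →
           A.trans (A.*-congʳ (A.trans (⟦⟧-cong (Δ_H-grouplike l<N i j)) (*-homo _ _))) (interchange _ _ _ _))) ⟩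
    OA.sumFin N (λ i → OA.sumFin N (λ j → (ι (grouplike l i) * X f (toℕ i)) * (ι (grouplike l j) * X g (toℕ j))))
      ≈⟨ ΣA.sumFin-cong N (λ i → A.sym (ΣA.sumFin-*ˡ N _ _)) ⟩
    OA.sumFin N (λ i → (ι (grouplike l i) * X f (toℕ i)) * OA.sumFin N (λ j → ι (grouplike l j) * X g (toℕ j)))
      ≈⟨ A.sym (ΣA.sumFin-*ʳ N _ _) ⟩
    OA.sumFin N (λ i → ι (grouplike l i) * X f (toℕ i)) * OA.sumFin N (λ j → ι (grouplike l j) * X g (toℕ j))
      ≈⟨ A.sym (A.*-cong (fun-coordinates f (grouplike l)) (fun-coordinates g (grouplike l))) ⟩
    fun f (grouplike l) * fun g (grouplike l) ∎
    where open CommutativeSemigroupProperties A.*-commutativeSemigroup using (interchange)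

  one-grouplike : ∀ l → one (grouplike l) ≈ 1#
  one-grouplike l = A.trans (⟦⟧-cong (R.trans (ε_H-value (binom l)) (binom-0 l))) 1#-homo

  TwoSidedInverse : Lin → Lin → Set _
  TwoSidedInverse f g = ∀ h → (conv f g h ≈ one h) × (conv g f h ≈ one h)

  discFactor-IsUnit : ∀ {f g : Lin} → TwoSidedInverse f g → ∀ l → l < N → UA.IsUnit (discFactor f l)
  discFactor-IsUnit {f} {g} g-inverse l l<N = discFactor g l , (begin
    discFactor f l * discFactor g l            ≈⟨ A.sym (A.*-cong (fun-grouplike f l<N) (fun-grouplike g l<N)) ⟩
    fun f (grouplike l) * fun g (grouplike l)  ≈⟨ A.sym (conv-grouplike f g l<N) ⟩
    conv f g (grouplike l)                     ≈⟨ proj₁ (g-inverse (grouplike l)) ⟩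
    one (grouplike l)                          ≈⟨ one-grouplike l ⟩
    1#                                         ∎)

  1+[N∸1]≡N : 1 ℕ.+ (N ∸ 1) ≡ N
  1+[N∸1]≡N = m+[n∸m]≡n 0<N

  Disc-IsUnit : ∀ (f : Lin) → (∀ l → l < N → UA.IsUnit (discFactor f l)) → UA.IsUnit (Disc f)
  Disc-IsUnit f units = UA.*-IsUnit
    (UA.IsUnit-resp (discFactor-0 f) (units 0 0<N))
    (UA.prodFrom-IsUnit 1 (N ∸ 1) (discFactor f) (λ l _ l<N → units l (≡.subst (l <_) 1+[N∸1]≡N l<N)))

  Disc-IsUnit⁻¹ : ∀ (f : Lin) → UA.IsUnit (Disc f) → ∀ l → l < N → UA.IsUnit (discFactor f l)
  Disc-IsUnit⁻¹ f unit zero    _   = UA.IsUnit-resp (A.sym (discFactor-0 f)) (UA.IsUnit-*ˡ unit)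
  Disc-IsUnit⁻¹ f unit (suc l) l<N =
    UA.prodFrom-IsUnit⁻¹ 1 (N ∸ 1) (discFactor f) (UA.IsUnit-*ʳ unit) (suc l) (s≤s z≤n)
                         (≡.subst (suc l <_) (≡.sym 1+[N∸1]≡N) l<N)

  convCoefficient-diagonal : ∀ (f : Lin) {s} → s < N → convCoefficient f s s ≈ discFactor f s
  convCoefficient-diagonal f {s} s<N = begin
    convCoefficient f s s                                ≈⟨ convCoefficient-formula f s s<N ⟩
    OA.fromℕ (s C s) * shiftedBinomialValue f (s ∸ s) s
      ≈⟨ A.*-cong (ΣA.≡⇒≈ (≡.cong OA.fromℕ (nCn≡1 s))) (ΣA.≡⇒≈ (≡.cong (λ m → shiftedBinomialValue f m s) (n∸n≡0 s))) ⟩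
    (1# + 0#) * shiftedBinomialValue f 0 s               ≈⟨ A.trans (A.*-congʳ (A.+-identityʳ 1#)) (A.*-identityˡ _) ⟩
    shiftedBinomialValue f 0 s                           ≈⟨ shiftedBinomialValue-0 f s ⟩
    discFactor f s                                       ∎

  right-inverse : ∀ (f : Lin) → (∀ l → l < N → UA.IsUnit (discFactor f l)) → Σ Lin λ g → ∀ h → conv f g h ≈ one h
  right-inverse f units = g , Lin-ext (convLin f g) oneLin (λ s s<N → begin
      conv f g (e s)                                       ≈⟨ conv-e f g s<N ⟩
      ΣA.∑< (suc s) (λ j → convCoefficient f s j * X g j)
        ≈⟨ ΣA.∑<-cong (suc s) (λ j j≤s → A.*-congˡ {convCoefficient f s j} (X-g j (≤-<-trans (≤-pred j≤s) s<N))) ⟩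
      ΣA.∑< (suc s) (λ j → convCoefficient f s j * y j)    ≈⟨ proj₂ solution s s<N ⟩
      (if s ≡ᵇ 0 then 1# else 0#)                          ≈⟨ one-e s ⟨
      one (e s)                                            ∎)
    where
    solution = UA.lower-triangular-solvable N (convCoefficient f) (λ s → if s ≡ᵇ 0 then 1# else 0#)
                 (λ s s<N → UA.IsUnit-resp (A.sym (convCoefficient-diagonal f s<N)) (units s s<N))
    y = proj₁ solution
    g = fromCoordinates (λ i → y (toℕ i))
    X-g : ∀ j → j < N → X g j ≈ y j
    X-g j j<N = A.trans (ΣA.≡⇒≈ (≡.cong (X g) (≡.sym (Finₚ.toℕ-fromℕ< j<N))))
                        (A.trans (X-fromCoordinates (λ i → y (toℕ i)) (fromℕ< j<N))
                                 (ΣA.≡⇒≈ (≡.cong y (Finₚ.toℕ-fromℕ< j<N))))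

  invertible⇒Disc-IsUnit : ∀ (f : Lin) → Σ Lin (TwoSidedInverse f) → UA.IsUnit (Disc f)
  invertible⇒Disc-IsUnit f (g , g-inverse) = Disc-IsUnit f (discFactor-IsUnit {f} {g} g-inverse)

  Disc-IsUnit⇒invertible : ∀ (f : Lin) → UA.IsUnit (Disc f) → Σ Lin (TwoSidedInverse f)
  Disc-IsUnit⇒invertible f Disc-unit =
    let g , g-right = right-inverse f (Disc-IsUnit⁻¹ f Disc-unit)
    in  g , λ h → g-right h , A.trans (conv-comm g f h) (g-right h)

1<p^n : ∀ {p n} → Prime p → 1 ≤ n → 1 < p ^ n
1<p^n {p} {n} p-prime 1≤n = <-≤-trans (ℕ.nonTrivial⇒n>1 p {{Primality.prime⇒nonTrivial p-prime}})
  (≤-trans (≤-reflexive (≡.sym (ℕₚ.*-identityʳ p))) (^-monoʳ-≤ p {{Primality.prime⇒nonZero p-prime}} 1≤n))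

proposition2p8 : {c ℓ a ℓa : Level} (p n : ℕ) → Prime p → 1 ≤ n
    → (R : CommutativeRing c ℓ) → CharP R p
    → (A : CommutativeRing a ℓa) (ι : CommutativeRing.Carrier R → CommutativeRing.Carrier A)
    → IsAlgebraMap R A ι
    → (lam : CommutativeRing.Carrier R)
    → let open GroupAlgebra R A ι lam (p ^ n) in
      -- A(Γ)(A) = Hom_R(H, A) ≅ A^(p^n) via f ↦ (X_{T^s}(f))_s, i.e. A(Γ) = Spec R[X_1, …, X_{T^(p^n-1)}]
      ((∀ (v : Fin (p ^ n) → A.Carrier) → Σ Lin λ f → ∀ i → X f (toℕ i) A.≈ v i)
       × (∀ (f g : Lin) → (∀ s → s < p ^ n → X f s A.≈ X g s) → ∀ h → fun f h A.≈ fun g h))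
      -- multiplication
      × (∀ (f g : Lin) (s : ℕ) → s < p ^ n → conv f g (e s) A.≈ productFormula f g s)
      -- multiplicative identity: X_1 ↦ 1, X_{T^s} ↦ 0
      × (∀ (s : ℕ) → s < p ^ n → one (e s) A.≈ (if s ≡ᵇ 0 then A.1# else A.0#))
      -- unit group: f is invertible in A(Γ)(A) iff Δ(f) is invertible in A
      × (∀ (f : Lin) →
           ((Σ Lin λ g → ∀ h → (conv f g h A.≈ one h) × (conv g f h A.≈ one h))
              → Σ A.Carrier λ u → Disc f A.* u A.≈ A.1#)
           × ((Σ A.Carrier λ u → Disc f A.* u A.≈ A.1#)
              → Σ Lin λ g → ∀ h → (conv f g h A.≈ one h) × (conv g f h A.≈ one h)))
-- (In the paper it makes Δ_H an algebra map.)
proposition2p8 p n p-prime 1≤n R _ A ι ι-hom lam =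
  ((λ v → fromCoordinates v , X-fromCoordinates v) , Lin-ext) ,
  (λ f g s s<N → conv-e-formula f g s<N) ,
  (λ s _ → one-e s) ,
  λ f → invertible⇒Disc-IsUnit f , Disc-IsUnit⇒invertible f
  where
  open Coordinates R A ι ι-hom lam (p ^ n)
  open Convolution R A ι ι-hom lam (p ^ n) (1<p^n p-prime 1≤n)
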